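{- Let $\mathcal{S}=\langle S,s_0,\tau,l\rangle$ be a $\Gamma$-labeled $\Upsilon$-transition system over input propositions $I$ and output propositions $O$, let $n\ge1$, $m\ge 0$, let $\varphi$ be a quantifier-free HyperLTL formula over $\mathrm{AP}=I\cup O$ with free trace variables among $\pi_1,\dots,\pi_n,\pi'_1,\dots,\pi'_m$, let $\psi$ be a quantifier-free HyperLTL formula over $\mathrm{AP}$ whose trace variables are among the universally quantified variables $\pi_1,\dots,\pi_n$, and let $p\notin\mathrm{AP}$ be a fresh atomic proposition. Then $\mathcal{S}\models\forall\pi_1\ldots\forall\pi_n.\ \exists\pi'_1\ldots\exists\pi'_m.\ \varphi$ if and only if $\mathcal{S}^{\{p\}}\models\forall\pi_1\ldots\forall\pi_n.\ \exists\pi'_1\ldots\exists\pi'_m.\ \mathsf{G}(p_{\pi_1}\leftrightarrow\psi)\rightarrow\varphi.$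
   Context: $\Upsilon=2^I$, $\Gamma=2^O$, $\Sigma=2^{\mathrm{AP}}$. A $\Gamma$-labeled $\Upsilon$-transition system $\mathcal{S}=\langle S,s_0,\tau,l\rangle$ has finite $S$, $s_0\in S$, $\tau\colon S\times\Upsilon\to S$, $l\colon S\to\Gamma$; $\tau^*(\epsilon)=s_0$, $\tau^*(x\upsilon)=\tau(\tau^*(x),\upsilon)$. The trace of $\mathcal{S}$ on $\upsilon_0\upsilon_1\ldots\in\Upsilon^\omega$ is $(\upsilon_0\cup\gamma_0)(\upsilon_1\cup\gamma_1)\ldots$ with $\gamma_i=l(\tau^*(\upsilon_0\cdots\upsilon_{i-1}))$, and $\mathit{traces}(\mathcal{S})$ is the set of all such traces. For a set $P$ of fresh propositions, $\mathcal{S}^P=\langle S,s_0,\tau^P,l\rangle$ is the $\Gamma$-labeled $2^{I\cup P}$-transition system with $\tau^P(s,\upsilon)=\tau(s,\upsilon\setminus P)$, i.e., the additional inputs $P$ are unconstrained and do not affect the behavior. HyperLTL: $\varphi::=\forall\pi.\varphi\mid\exists\pi.\varphi\mid\psi$, $\psi::=a_\pi\mid\neg\psi\mid\psi\vee\psi\mid\mathsf{X}\psi\mid\psi\mathsf{U}\psi$, with derived $\rightarrow,\leftrightarrow,\mathsf{F},\mathsf{G}$; under an assignment $\Pi$ of traces to variables, $a_\pi$ holds at position $i$ iff $a\in\Pi(\pi)[i]$, temporal operators have the standard LTL semantics, and $\exists\pi$/$\forall\pi$ range over the traces of the system; $\mathcal{S}\models\varphi$ iff $\varphi$ holds at position $0$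 under the empty assignment with quantifiers over $\mathit{traces}(\mathcal{S})$. -}

module Defs where

open import Level using (0ℓ)
open import Data.Nat using (ℕ; zero; suc; _≤_; _<_)
open import Data.Bool using (Bool; true; false)
open import Data.Fin using (Fin; zero; suc)
open import Data.Sum using (_⊎_; inj₁; inj₂; [_,_])
open import Data.Product using (Σ; _×_; ∃)
open import Data.Unit using (⊤; tt)
open import Relation.Nullary using (¬_)
open import Relation.Binary.PropositionalEquality using (_≡_)

Val : Set → Set
Val X = X → Bool

-- Γ-labeled Υ-transition systems, Υ = 2^I, Γ = 2^O, finite state set Fin nS

record TS (I O : Set) : Set where
  field
    nS : ℕ
    s₀ : Fin nS
    τ  : Fin nS → Val I → Fin nS
    l  : Fin nS → Val O

open TS public

InWord : Set → Set
InWord I = ℕ → Val I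

Trace : Set → Set
Trace AP = ℕ → Val AP

state : ∀ {I O} (𝒮 : TS I O) → InWord I → ℕ → Fin (nS 𝒮)
state 𝒮 w zero    = s₀ 𝒮
state 𝒮 w (suc i) = τ 𝒮 (state 𝒮 w i) (w i)

-- trace of 𝒮 on w: position i is υᵢ ∪ γᵢ over AP = I ∪ O (disjoint union I ⊎ O)
trace : ∀ {I O} (𝒮 : TS I O) → InWord I → Trace (I ⊎ O)
trace 𝒮 w i (inj₁ a) = w i a
trace 𝒮 w i (inj₂ o) = l 𝒮 (state 𝒮 w i) o

-- 𝒮^P : additional unconstrained inputs P, τ^P(s,υ) = τ(s, υ \ P)
extend : ∀ {I O} (P : Set) → TS I O → TS (I ⊎ P) O
extend P 𝒮 = record
  { nS = nS 𝒮
  ; s₀ = s₀ 𝒮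
  ; τ  = λ s υ → τ 𝒮 s (λ a → υ (inj₁ a))
  ; l  = l 𝒮
  }

data QF (V AP : Set) : Set where
  atom : AP → V → QF V AP
  ¬'_  : QF V AP → QF V AP
  _∨'_ : QF V AP → QF V AP → QF V AP
  X'_  : QF V AP → QF V AP
  _U'_ : QF V AP → QF V AP → QF V AP

module _ {V AP : Set} where
  _∧'_ : QF V AP → QF V AP → QF V AP
  φ ∧' ψ = ¬' ((¬' φ) ∨' (¬' ψ))

  _→'_ : QF V AP → QF V AP → QF V AP
  φ →' ψ = (¬' φ) ∨' ψ

  _↔'_ : QF V AP → QF V AP → QF V AP
  φ ↔' ψ = (φ →' ψ) ∧' (ψ →' φ)

  -- true is written φ ∨ ¬φ
  F'_ : QF V AP → QF V AP
  F' φ = (φ ∨' (¬' φ)) U' φ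

  G'_ : QF V AP → QF V AP
  G' φ = ¬' (F' (¬' φ))

rename : ∀ {V V' AP AP'} → (V → V') → (AP → AP') → QF V AP → QF V' AP'
rename f g (atom a π) = atom (g a) (f π)
rename f g (¬' φ)     = ¬' rename f g φ
rename f g (φ ∨' ψ)   = rename f g φ ∨' rename f g ψ
rename f g (X' φ)     = X' rename f g φ
rename f g (φ U' ψ)   = rename f g φ U' rename f g ψ

Holds : ∀ {V AP} → (V → Trace AP) → ℕ → QF V AP → Set
Holds Π i (atom a π) = Π π i a ≡ true
Holds Π i (¬' φ)     = ¬ Holds Π i φ
Holds Π i (φ ∨' ψ)   = Holds Π i φ ⊎ Holds Π i ψ
Holds Π i (X' φ)     = Holds Π (suc i) φ
Holds Π i (φ U' ψ)   =
  Σ ℕ λ k → i ≤ k × Holds Π k ψ × (∀ j → i ≤ j → j < k → Holds Π j φ)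

-- Nested quantifier prefixes ∀x₁…∀x_k / ∃x₁…∃x_k (x₁ outermost)

_∷ᶠ_ : ∀ {A : Set} {k} → A → (Fin k → A) → Fin (suc k) → A
(a ∷ᶠ as) zero    = a
(a ∷ᶠ as) (suc i) = as i

Forall : {A : Set} (k : ℕ) → ((Fin k → A) → Set) → Set
Forall zero    P = P (λ ())
Forall {A} (suc k) P = (a : A) → Forall k (λ as → P (a ∷ᶠ as))

Exists : {A : Set} (k : ℕ) → ((Fin k → A) → Set) → Set
Exists zero    P = P (λ ())
Exists {A} (suc k) P = Σ A λ a → Exists k (λ as → P (a ∷ᶠ as))

-- 𝒮 ⊨ ∀π₁…∀πₙ. ∃π'₁…∃π'ₘ. φ  ; variables πᵢ = inj₁ i, π'ⱼ = inj₂ j.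
-- Trace quantifiers range over traces(𝒮) = { trace 𝒮 w | w ∈ Υ^ω },
-- represented by their input words.
_⊨∀∃_ : ∀ {I O} (𝒮 : TS I O) {n m : ℕ} → QF (Fin n ⊎ Fin m) (I ⊎ O) → Set
_⊨∀∃_ {I} {O} 𝒮 {n} {m} φ =
  Forall {InWord I} n λ ws → Exists {InWord I} m λ ws' →
    Holds {Fin n ⊎ Fin m} {I ⊎ O} (λ v → trace 𝒮 ([ ws , ws' ] v)) 0 φ

-- embedding AP = I ∪ O into AP ∪ {p} = (I ∪ {p}) ∪ O
embedAP : ∀ {I O : Set} → I ⊎ O → (I ⊎ ⊤) ⊎ O
embedAP (inj₁ a) = inj₁ (inj₁ a)
embedAP (inj₂ o) = inj₂ o

pProp : ∀ {I O : Set} → (I ⊎ ⊤) ⊎ O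
pProp = inj₁ (inj₂ tt)

module Submission where

-- Traces of the extended system 𝒮^{p} are the traces of 𝒮 with an arbitrary
-- additional p-column, and φ does not mention p.  Hence:
--  (⇒) given universal traces of 𝒮^{p}, forget their p-columns, take the
--      existential witnesses for φ in 𝒮, and extend them by any p-column;
--      the conclusion φ of the implication holds.
--  (⇐) given universal traces of 𝒮, choose the p-column of every universal
--      trace as the characteristic sequence of ψ (this needs excluded middle,
--      since ψ is not decidable constructively); then the premise
--      G(p_{π₁} ↔ ψ) holds, so the witnesses found in 𝒮^{p} satisfy φ.

open import Defs
open import Level using (0ℓ)
open import Axiom.ExcludedMiddle using (ExcludedMiddle)
open import Data.Nat using (ℕ; _≤_; zero; suc)
open import Data.Fin using (Fin; fromℕ<; zero; suc)
open import Data.Sum using (_⊎_; inj₁; inj₂; [_,_])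
open import Data.Unit using (⊤; tt)
open import Data.Bool using (true; false)
open import Data.Product using (Σ; _,_; _×_)
open import Data.Empty using (⊥-elim)
open import Function using (id)
open import Function.Bundles using (_⇔_; mk⇔)
open import Relation.Nullary using (Dec; yes; no; does)
open import Relation.Nullary.Decidable using (dec-true)
open import Relation.Binary.PropositionalEquality
  using (_≡_; _≗_; refl; sym; trans; cong)

-- Without function extensionality, Forall k P only
-- yields P at an assignment pointwise equal to a given one, and dually
-- Exists k P is introduced by P at every assignment pointwise equal to it.

Forall-intro : ∀ {A : Set} k {P : (Fin k → A) → Set} → (∀ ws → P ws) → Forall k P
Forall-intro zero    h   = h _
Forall-intro (suc k) h a = Forall-intro k (λ ws → h (a ∷ᶠ ws))

Forall-elim : ∀ {A : Set} k {P : (Fin k → A) → Set} → Forall k P →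
  (ws : Fin k → A) → Σ (Fin k → A) λ ws₀ → ws₀ ≗ ws × P ws₀
Forall-elim zero    h ws = (λ ()) , (λ ()) , h
Forall-elim (suc k) h ws with Forall-elim k (h (ws zero)) (λ x → ws (suc x))
... | ws₀ , ws₀≗ws , p = (ws zero ∷ᶠ ws₀) , (λ { zero → refl ; (suc x) → ws₀≗ws x }) , p

Exists-intro : ∀ {A : Set} k {P : (Fin k → A) → Set} (ws : Fin k → A) →
  (∀ as → as ≗ ws → P as) → Exists k P
Exists-intro zero    ws h = h _ (λ ())
Exists-intro (suc k) ws h = ws zero , Exists-intro k (λ x → ws (suc x))
  (λ as as≗ws → h (ws zero ∷ᶠ as) (λ { zero → refl ; (suc x) → as≗ws x }))

Exists-elim : ∀ {A : Set} k {P : (Fin k → A) → Set} → Exists k P → Σ (Fin k → A) P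
Exists-elim zero    h       = _ , h
Exists-elim (suc k) (a , h) with Exists-elim k h
... | ws , p = (a ∷ᶠ ws) , p

module RenameSemantics {V V' AP AP' : Set} (f : V → V') (g : AP → AP')
  (Π : V → Trace AP) (Π' : V' → Trace AP')
  (agree : ∀ v i a → Π' (f v) i (g a) ≡ Π v i a) where

  rename⁺ : ∀ i φ → Holds Π i φ → Holds Π' i (rename f g φ)
  rename⁻ : ∀ i φ → Holds Π' i (rename f g φ) → Holds Π i φ

  rename⁺ i (atom a π) h                  = trans (agree π i a) h
  rename⁺ i (¬' φ)     h                  = λ h' → h (rename⁻ i φ h')
  rename⁺ i (φ ∨' ψ)   (inj₁ h)           = inj₁ (rename⁺ i φ h)
  rename⁺ i (φ ∨' ψ)   (inj₂ h)           = inj₂ (rename⁺ i ψ h)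
  rename⁺ i (X' φ)     h                  = rename⁺ (suc i) φ h
  rename⁺ i (φ U' ψ)   (k , i≤k , hψ , hφ) =
    k , i≤k , rename⁺ k ψ hψ , λ j i≤j j<k → rename⁺ j φ (hφ j i≤j j<k)

  rename⁻ i (atom a π) h                  = trans (sym (agree π i a)) h
  rename⁻ i (¬' φ)     h                  = λ h' → h (rename⁺ i φ h')
  rename⁻ i (φ ∨' ψ)   (inj₁ h)           = inj₁ (rename⁻ i φ h)
  rename⁻ i (φ ∨' ψ)   (inj₂ h)           = inj₂ (rename⁻ i ψ h)
  rename⁻ i (X' φ)     h                  = rename⁻ (suc i) φ h
  rename⁻ i (φ U' ψ)   (k , i≤k , hψ , hφ) =
    k , i≤k , rename⁻ k ψ hψ , λ j i≤j j<k → rename⁻ j φ (hφ j i≤j j<k)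

-- Derived connectives.  ↔' is encoded through ¬' and ∨', but its truth
-- follows from mutual implication without any decidability, since the
-- outermost connective is a negation.

module _ {V AP : Set} {Π : V → Trace AP} where

  →'-intro : ∀ {i} φ ψ → Holds Π i ψ → Holds Π i (φ →' ψ)
  →'-intro φ ψ = inj₂

  →'-elim : ∀ {i} φ ψ → Holds Π i (φ →' ψ) → Holds Π i φ → Holds Π i ψ
  →'-elim φ ψ (inj₁ ¬φ) hφ = ⊥-elim (¬φ hφ)
  →'-elim φ ψ (inj₂ hψ) hφ = hψ

  ↔'-intro : ∀ {i} φ ψ →
    (Holds Π i φ → Holds Π i ψ) → (Holds Π i ψ → Holds Π i φ) → Holds Π i (φ ↔' ψ)
  ↔'-intro φ ψ φ⇒ψ ψ⇒φ (inj₁ ¬[φ→ψ]) = ¬[φ→ψ] (inj₁ λ hφ → ¬[φ→ψ] (inj₂ (φ⇒ψ hφ)))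
  ↔'-intro φ ψ φ⇒ψ ψ⇒φ (inj₂ ¬[ψ→φ]) = ¬[ψ→φ] (inj₁ λ hψ → ¬[ψ→φ] (inj₂ (ψ⇒φ hψ)))

  G'-intro : ∀ {i} φ → (∀ k → Holds Π k φ) → Holds Π i (G' φ)
  G'-intro φ always (k , _ , ¬φ , _) = ¬φ (always k)

module Extension {I O : Set} (𝒮 : TS I O) where

  forget : ∀ {P} → InWord (I ⊎ P) → InWord I
  forget w k a = w k (inj₁ a)

  withColumn : ∀ {P} → InWord I → (ℕ → Val P) → InWord (I ⊎ P)
  withColumn w c k (inj₁ a) = w k a
  withColumn w c k (inj₂ q) = c k q

  state-forget : ∀ {P} (w : InWord (I ⊎ P)) i →
    state (extend P 𝒮) w i ≡ state 𝒮 (forget w) i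
  state-forget w zero    = refl
  state-forget w (suc i) = cong (λ s → τ 𝒮 s (forget w i)) (state-forget w i)

  trace-forget : ∀ (w : InWord (I ⊎ ⊤)) i a →
    trace (extend ⊤ 𝒮) w i (embedAP a) ≡ trace 𝒮 (forget w) i a
  trace-forget w i (inj₁ a) = refl
  trace-forget w i (inj₂ o) = cong (λ s → l 𝒮 s o) (state-forget w i)

  env-forget : ∀ {n m} (A : Fin n → InWord (I ⊎ ⊤)) (B : Fin m → InWord (I ⊎ ⊤))
    (A₀ : Fin n → InWord I) (B₀ : Fin m → InWord I) →
    (∀ x → A₀ x ≡ forget (A x)) → (∀ y → B₀ y ≡ forget (B y)) →
    ∀ v i a → trace (extend ⊤ 𝒮) ([ A , B ] v) i (embedAP a) ≡ trace 𝒮 ([ A₀ , B₀ ] v) i a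
  env-forget A B A₀ B₀ eA eB (inj₁ x) i a rewrite eA x = trace-forget (A x) i a
  env-forget A B A₀ B₀ eA eB (inj₂ y) i a rewrite eB y = trace-forget (B y) i a

does-true⁻¹ : ∀ {P : Set} (d : Dec P) → does d ≡ true → P
does-true⁻¹ (yes p) _ = p
does-true⁻¹ (no _) ()

module Reduction {I O : Set} (𝒮 : TS I O) {n m : ℕ} (π₁ : Fin n)
  (φ : QF (Fin n ⊎ Fin m) (I ⊎ O)) (ψ : QF (Fin n) (I ⊎ O)) where

  open Extension 𝒮

  𝒮⁺ : TS (I ⊎ ⊤) O
  𝒮⁺ = extend ⊤ 𝒮

  p₁ ψ⁺ : QF (Fin n ⊎ Fin m) ((I ⊎ ⊤) ⊎ O)
  p₁ = atom pProp (inj₁ π₁)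
  ψ⁺ = rename inj₁ embedAP ψ

  pSpec : QF (Fin n ⊎ Fin m) ((I ⊎ ⊤) ⊎ O)
  pSpec = G' (p₁ ↔' ψ⁺)

  φ⁺ : QF (Fin n ⊎ Fin m) ((I ⊎ ⊤) ⊎ O)
  φ⁺ = rename id embedAP φ

  guarded-sound : 𝒮 ⊨∀∃ φ → 𝒮⁺ ⊨∀∃ (pSpec →' φ⁺)
  guarded-sound H = Forall-intro n λ ws⁺ →
    let (ws₀ , ws₀≗ , E) = Forall-elim n H (λ x → forget (ws⁺ x))
        (ws' , hφ)        = Exists-elim m E
        padded            = λ y → withColumn (ws' y) (λ _ _ → false)
    in Exists-intro m padded λ as as≗padded →
      let agree = env-forget ws⁺ as ws₀ ws' ws₀≗ (λ y → cong forget (sym (as≗padded y)))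
      in →'-intro pSpec φ⁺ (RenameSemantics.rename⁺ id embedAP _ _ agree 0 φ hφ)

  guard-holds : (Π⁺ : Fin n ⊎ Fin m → Trace ((I ⊎ ⊤) ⊎ O)) (Πψ : Fin n → Trace (I ⊎ O)) →
    (∀ v i a → Π⁺ (inj₁ v) i (embedAP a) ≡ Πψ v i a) →
    (ψ? : ∀ k → Dec (Holds Πψ k ψ)) → (∀ k → Π⁺ (inj₁ π₁) k pProp ≡ does (ψ? k)) →
    Holds Π⁺ 0 pSpec
  guard-holds Π⁺ Πψ agreeψ ψ? p≡ψ? = G'-intro (p₁ ↔' ψ⁺) λ k → ↔'-intro p₁ ψ⁺
    (λ p → rename⁺ k ψ (does-true⁻¹ (ψ? k) (trans (sym (p≡ψ? k)) p)))
    (λ q → trans (p≡ψ? k) (dec-true (ψ? k) (rename⁻ k ψ q)))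
    where open RenameSemantics inj₁ embedAP Πψ Π⁺ agreeψ

  -- (⇐): p is set to the truth value of ψ, so the guard pSpec holds
  guarded-complete : ExcludedMiddle 0ℓ → 𝒮⁺ ⊨∀∃ (pSpec →' φ⁺) → 𝒮 ⊨∀∃ φ
  guarded-complete em H = Forall-intro n λ ws →
    let Πψ       = λ v → trace 𝒮 (ws v)
        ψ?       = λ k → em {Holds Πψ k ψ}
        labelled = λ x → withColumn (ws x) (λ k _ → does (ψ? k))
        (ws⁺ , ws⁺≗ , E) = Forall-elim n H labelled
        (ws⁺' , hφ⁺)      = Exists-elim m E
        Π⁺       = λ v → trace 𝒮⁺ ([ ws⁺ , ws⁺' ] v)
    in Exists-intro m (λ y → forget (ws⁺' y)) λ as as≗ →
      let agree = env-forget ws⁺ ws⁺' ws as (λ x → sym (cong forget (ws⁺≗ x))) as≗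
          guard = guard-holds Π⁺ Πψ (λ v → agree (inj₁ v)) ψ?
                    (λ k → cong (λ w → w k (inj₂ tt)) (ws⁺≗ π₁))
      in RenameSemantics.rename⁻ id embedAP _ _ agree 0 φ (→'-elim pSpec φ⁺ hφ⁺ guard)

theorem5 : ExcludedMiddle 0ℓ →
    (ni no : ℕ) (𝒮 : TS (Fin ni) (Fin no)) (n m : ℕ) (hn : 1 ≤ n) →
    (φ : QF (Fin n ⊎ Fin m) (Fin ni ⊎ Fin no)) →
    (ψ : QF (Fin n) (Fin ni ⊎ Fin no)) →
    (𝒮 ⊨∀∃ φ)
    ⇔ (extend ⊤ 𝒮 ⊨∀∃
         ((G' (atom pProp (inj₁ (fromℕ< hn)) ↔' rename inj₁ embedAP ψ))
           →' rename id embedAP φ))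
theorem5 em _ _ 𝒮 n m hn φ ψ =
  mk⇔ guarded-sound (guarded-complete em)
  where open Reduction 𝒮 (fromℕ< hn) φ ψ
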